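{- Let $D$ be an $n\times n$ distance matrix, and let $q_0$ be the smallest $q\in\mathbb{N}$ such that $D^{(q)}=D$, where $D^{(q)}$ is the distance matrix of the $q$-skeleton of $D$. Then there exists a graph realisation $(G=(V,E),\Phi)$ of $D$ with \[|V|\le n+\sum_{1\le i<j\le n,\ 2\le D_{ij}\le q_0}(D_{ij}-1).\]
   Context: $[n]=\{1,\dots,n\}$. An $n\times n$ matrix $D$ with non-negative integer entries is a distance matrix if all diagonal entries are $0$, all off-diagonal entries are strictly positive, $D$ is symmetric, and $D_{iw}+D_{wj}\ge D_{ij}$ for all $i,j,w$. A graph realisation of $D$ is a pair $(G,\Phi)$ with $G=(V,E)$ a finite simple undirected unweighted graph and $\Phi:[n]\to V$ injective such that $d_G(\Phi(i),\Phi(j))=D_{ij}$ for all $i,j$ ($d_G$ the shortest-path distance). For $q\in\mathbb{N}$, the $q$-skeleton of $D$ is the edge-weighted graph $G^q$ with vertex set $[n]$, an edge $\{i,j\}$ ($i<j$) if and only if $D_{ij}\le q$, and weight (length) $D_{ij}$ on that edge; the distance matrix of the $q$-skeleton is the $n\times n$ matrix $D^{(q)}$ with $D^{(q)}_{ij}$ the length of a shortest path from $i$ to $j$ in $G^q$ ($\infty$ if none exists). -}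

module Defs where

open import Data.Nat using (ℕ; zero; suc; _+_; _∸_; _≤_; _<_; _≤?_; _<?_)
open import Data.Fin using (Fin; toℕ)
open import Data.Bool using (Bool; true; false)
open import Data.List using (List; map; concatMap; allFin)
open import Data.Nat.ListAction using (sum)
open import Data.Product using (Σ; _×_; ∃; _,_)
open import Relation.Binary.PropositionalEquality using (_≡_; _≢_)
open import Relation.Nullary using (yes; no; _×-dec_)
open import Function.Definitions using (Injective)

Matrix : ℕ → Set
Matrix n = Fin n → Fin n → ℕ

record IsDistanceMatrix {n : ℕ} (D : Matrix n) : Set where
  field
    diag     : ∀ i → D i i ≡ 0
    offdiag  : ∀ i j → i ≢ j → 0 < D i j
    symm     : ∀ i j → D i j ≡ D j i
    triangle : ∀ i j w → D i j ≤ D i w + D w j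

-- q-skeleton: edge {i,j} (i ≠ j) iff D i j ≤ q, with length D i j.
-- SkelWalk D q i j L : a walk from i to j in G^q of total length L.
data SkelWalk {n : ℕ} (D : Matrix n) (q : ℕ) : Fin n → Fin n → ℕ → Set where
  here : ∀ {i} → SkelWalk D q i i 0
  step : ∀ {i k j L} → i ≢ k → D i k ≤ q →
         SkelWalk D q k j L → SkelWalk D q i j (D i k + L)

-- D^(q)_{ij} = d : d is the length of a shortest i–j walk in G^q.
-- (With nonnegative lengths, shortest walk length = shortest path length.)
SkelDist : {n : ℕ} → Matrix n → ℕ → Fin n → Fin n → ℕ → Set
SkelDist D q i j d = SkelWalk D q i j d × (∀ L → SkelWalk D q i j L → d ≤ L)

-- D^(q) = D  (in particular no entry of D^(q) is ∞).
SkeletonExact : {n : ℕ} → Matrix n → ℕ → Set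
SkeletonExact D q = ∀ i j → SkelDist D q i j (D i j)

IsLeastSkeletonIndex : {n : ℕ} → Matrix n → ℕ → Set
IsLeastSkeletonIndex D q0 = SkeletonExact D q0 × (∀ q → SkeletonExact D q → q0 ≤ q)

record SimpleGraph (m : ℕ) : Set where
  field
    Adj   : Fin m → Fin m → Bool
    sym   : ∀ u v → Adj u v ≡ Adj v u
    irrefl : ∀ v → Adj v v ≡ false

data Walk {m : ℕ} (G : SimpleGraph m) : Fin m → Fin m → ℕ → Set where
  here : ∀ {u} → Walk G u u 0
  step : ∀ {u w v k} → SimpleGraph.Adj G u w ≡ true →
         Walk G w v k → Walk G u v (suc k)

GraphDist : {m : ℕ} → SimpleGraph m → Fin m → Fin m → ℕ → Set
GraphDist G u v d = Walk G u v d × (∀ k → Walk G u v k → d ≤ k)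

record Realisation {n : ℕ} (D : Matrix n) (m : ℕ) : Set where
  field
    graph : SimpleGraph m
    Φ     : Fin n → Fin m
    Φ-inj : Injective _≡_ _≡_ Φ
    dist  : ∀ i j → GraphDist graph (Φ i) (Φ j) (D i j)

pairTerm : {n : ℕ} → Matrix n → ℕ → Fin n → Fin n → ℕ
pairTerm D q0 i j with (toℕ i <? toℕ j) ×-dec ((2 ≤? D i j) ×-dec (D i j ≤? q0))
... | yes _ = D i j ∸ 1
... | no  _ = 0

extraVertices : {n : ℕ} → Matrix n → ℕ → ℕ
extraVertices {n} D q0 =
  sum (concatMap (λ i → map (λ j → pairTerm D q0 i j) (allFin n)) (allFin n))

{-# OPTIONS --safe #-}
module Submission where

-- Realise D on the terminals [n] together with, for every i < j with 2 ≤ D_ij ≤ q0, a fresh path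
-- of D_ij − 1 interior vertices from i to j; pairs with D_ij = 1 become edges. Every edge of the
-- q0-skeleton is then traced by a walk of the same length, so D^(q0) = D gives d_G ≤ D.
-- Conversely, fix a terminal c and give a terminal a the potential D_ac and the vertex at
-- distance t from i on the path of {i, j} the potential min (t + D_ic, D_ij − t + D_jc). By the
-- triangle inequality the potential changes by at most 1 along every edge, so d_G(a, c) ≥ D_ac.

open import Defs
open import Data.Nat using (ℕ; zero; suc; _+_; _∸_; _⊓_; _≤_; _<_; z≤n; z<s; s≤s; _≟_; _≤?_; _<?_)
open import Data.Nat.Properties
open import Data.Nat.ListAction using (sum)
open import Data.Fin as Fin using (Fin; toℕ; splitAt; _↑ˡ_; _↑ʳ_; fromℕ<)
open import Data.Fin.Properties using (splitAt-↑ˡ; splitAt-↑ʳ; toℕ<n; toℕ-fromℕ<; toℕ-injective)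
open import Data.Bool using (true)
open import Data.List using (List; []; _∷_; map; concatMap; allFin; _++_; cartesianProduct)
open import Data.List.Properties using (map-++; map-∘)
open import Data.List.Membership.Propositional using (_∈_)
open import Data.List.Membership.Propositional.Properties using (∈-allFin; ∈-cartesianProduct⁺)
open import Data.List.Relation.Unary.Any using (here; there)
open import Data.Product using (Σ; _×_; _,_; proj₁; uncurry)
open import Data.Sum using (_⊎_; inj₁; inj₂; [_,_]′)
import Data.Sum as Sum
open import Function using (_∘_; mk⇔)
open import Relation.Binary.Definitions using (Decidable; Symmetric; tri<; tri≈; tri>)
open import Relation.Binary.PropositionalEquality
open import Relation.Nullary using (Dec; yes; no; does; ¬_; contradiction; _×-dec_; _⊎-dec_)
open import Relation.Nullary.Decidable using (does-⇔; dec-true; dec-false)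

module _ {A : Set} (w : A → ℕ) where

  fromFinSum : ∀ xs → Fin (sum (map w xs)) → Σ A (Fin ∘ w)
  fromFinSum (x ∷ xs) k = [ (x ,_) , fromFinSum xs ]′ (splitAt (w x) k)

  toFinSum : ∀ {a xs} → a ∈ xs → Fin (w a) → Fin (sum (map w xs))
  toFinSum {xs = x ∷ xs} (here refl) t = t ↑ˡ sum (map w xs)
  toFinSum {xs = x ∷ xs} (there a∈xs) t = w x ↑ʳ toFinSum a∈xs t

  fromFinSum-toFinSum : ∀ {a xs} (a∈xs : a ∈ xs) (t : Fin (w a)) →
                        fromFinSum xs (toFinSum a∈xs t) ≡ (a , t)
  fromFinSum-toFinSum {xs = x ∷ xs} (here refl) t
    rewrite splitAt-↑ˡ (w x) t (sum (map w xs)) = refl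
  fromFinSum-toFinSum {xs = x ∷ xs} (there a∈xs) t
    rewrite splitAt-↑ʳ (w x) (sum (map w xs)) (toFinSum a∈xs t) = fromFinSum-toFinSum a∈xs t

map-uncurry-cartesianProduct : ∀ {A B C : Set} (f : A → B → C) xs (ys : List B) →
  map (uncurry f) (cartesianProduct xs ys) ≡ concatMap (λ x → map (f x) ys) xs
map-uncurry-cartesianProduct f [] ys = refl
map-uncurry-cartesianProduct f (x ∷ xs) ys = begin
  map (uncurry f) (map (x ,_) ys ++ cartesianProduct xs ys)
    ≡⟨ map-++ (uncurry f) (map (x ,_) ys) (cartesianProduct xs ys) ⟩
  map (uncurry f) (map (x ,_) ys) ++ map (uncurry f) (cartesianProduct xs ys)
    ≡⟨ cong₂ _++_ (sym (map-∘ ys)) (map-uncurry-cartesianProduct f xs ys) ⟩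
  map (f x) ys ++ concatMap (λ x → map (f x) ys) xs ∎
  where open ≡-Reasoning

m∸n≤1+m∸[1+n] : ∀ m n → m ∸ n ≤ suc (m ∸ suc n)
m∸n≤1+m∸[1+n] zero    zero    = z≤n
m∸n≤1+m∸[1+n] zero    (suc n) = z≤n
m∸n≤1+m∸[1+n] (suc m) zero    = ≤-refl
m∸n≤1+m∸[1+n] (suc m) (suc n) = m∸n≤1+m∸[1+n] m n

module _ {m : ℕ} {G : SimpleGraph m} where
  open SimpleGraph G using (Adj)

  adj-sym : ∀ {x y} → Adj x y ≡ true → Adj y x ≡ true
  adj-sym {x} {y} xy = trans (SimpleGraph.sym G y x) xy

  walk-++ : ∀ {x y z k l} → Walk G x y k → Walk G y z l → Walk G x z (k + l)
  walk-++ here       q = q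
  walk-++ (step a p) q = step a (walk-++ p q)

  walk-∷ʳ : ∀ {x y z k} → Walk G x y k → Adj y z ≡ true → Walk G x z (suc k)
  walk-∷ʳ here       a = step a here
  walk-∷ʳ (step b p) a = step b (walk-∷ʳ p a)

  walk-reverse : ∀ {x y k} → Walk G x y k → Walk G y x k
  walk-reverse here       = here
  walk-reverse (step a p) = walk-∷ʳ (walk-reverse p) (adj-sym a)

  Lipschitz : (Fin m → ℕ) → Set
  Lipschitz h = ∀ {x y} → Adj x y ≡ true → h x ≤ suc (h y)

  Lipschitz⇒≤-walk : ∀ {h} → Lipschitz h → ∀ {x y k} → Walk G x y k → h x ≤ k + h y
  Lipschitz⇒≤-walk lip here       = ≤-refl
  Lipschitz⇒≤-walk lip (step a p) = ≤-trans (lip a) (s≤s (Lipschitz⇒≤-walk lip p))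

module RelationGraph {V : Set} {R : V → V → Set}
                     (R? : Decidable R) (R-sym : Symmetric R) (R-irrefl : ∀ v → ¬ R v v)
                     {m : ℕ} (encode : V → Fin m) (decode : Fin m → V)
                     (decode-encode : ∀ v → decode (encode v) ≡ v) where

  graph : SimpleGraph m
  graph = record
    { Adj    = λ x y → does (R? (decode x) (decode y))
    ; sym    = λ x y → does-⇔ (mk⇔ R-sym R-sym) (R? (decode x) (decode y))
                                                 (R? (decode y) (decode x))
    ; irrefl = λ x → dec-false (R? (decode x) (decode x)) (R-irrefl (decode x))
    }

  adj⇒related : ∀ {x y} → SimpleGraph.Adj graph x y ≡ true → R (decode x) (decode y)
  adj⇒related {x} {y} adj with R? (decode x) (decode y)
  ... | yes r = r

  related⇒adj : ∀ u v → R u v → SimpleGraph.Adj graph (encode u) (encode v) ≡ true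
  related⇒adj u v r rewrite decode-encode u | decode-encode v = dec-true (R? u v) r

  encode-injective : ∀ {u v} → encode u ≡ encode v → u ≡ v
  encode-injective {u} {v} e = trans (sym (decode-encode u)) (trans (cong decode e) (decode-encode v))

module SkeletonRealisation {n : ℕ} {D : Matrix n} (D-dist : IsDistanceMatrix D) (q : ℕ) where
  open IsDistanceMatrix D-dist
  open ≤-Reasoning

  -- internal i j s lies at distance s + 1 from i on the path replacing {i, j}; that path has
  -- pairTerm D q i j interior vertices, which is 0 unless i < j and 2 ≤ D i j ≤ q.
  data Vertex : Set where
    terminal : Fin n → Vertex
    internal : (i j : Fin n) (s : ℕ) → .(s < pairTerm D q i j) → Vertex

  Attached : Fin n → Fin n → Fin n → ℕ → Set
  Attached a i j s = (a ≡ i × s ≡ 0) ⊎ (a ≡ j × suc (suc s) ≡ D i j)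

  Consecutive : ℕ → ℕ → Set
  Consecutive s s′ = suc s ≡ s′ ⊎ s ≡ suc s′

  Edge : Vertex → Vertex → Set
  Edge (terminal a)       (terminal b)          = D a b ≡ 1
  Edge (terminal a)       (internal i j s _)    = Attached a i j s
  Edge (internal i j s _) (terminal a)          = Attached a i j s
  Edge (internal i j s _) (internal i′ j′ s′ _) = i ≡ i′ × j ≡ j′ × Consecutive s s′

  attached? : ∀ a i j s → Dec (Attached a i j s)
  attached? a i j s = (a Fin.≟ i ×-dec s ≟ 0) ⊎-dec (a Fin.≟ j ×-dec suc (suc s) ≟ D i j)

  edge? : Decidable Edge
  edge? (terminal a)       (terminal b)          = D a b ≟ 1
  edge? (terminal a)       (internal i j s _)    = attached? a i j s
  edge? (internal i j s _) (terminal a)          = attached? a i j s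
  edge? (internal i j s _) (internal i′ j′ s′ _) =
    i Fin.≟ i′ ×-dec j Fin.≟ j′ ×-dec (suc s ≟ s′ ⊎-dec s ≟ suc s′)

  edge-sym : Symmetric Edge
  edge-sym {terminal a}       {terminal b}          e = trans (symm b a) e
  edge-sym {terminal a}       {internal i j s _}    e = e
  edge-sym {internal i j s _} {terminal a}          e = e
  edge-sym {internal i j s _} {internal i′ j′ s′ _} (refl , refl , c) =
    refl , refl , Sum.swap (Sum.map sym sym c)

  edge-irrefl : ∀ v → ¬ Edge v v
  edge-irrefl (terminal a)       e                   = 0≢1+n (trans (sym (diag a)) e)
  edge-irrefl (internal i j s _) (_ , _ , inj₁ e)    = 1+n≢n e
  edge-irrefl (internal i j s _) (_ , _ , inj₂ e)    = 1+n≢n (sym e)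

  potential : Fin n → Vertex → ℕ
  potential c (terminal a)       = D a c
  potential c (internal i j s _) = (suc s + D i c) ⊓ (D i j ∸ suc s + D j c)

  potential-edge : ∀ c {u v} → Edge u v → potential c u ≤ suc (potential c v)
  potential-edge c {terminal a} {terminal b} Dab≡1 = begin
    D a c         ≤⟨ triangle a c b ⟩
    D a b + D b c ≡⟨ cong (_+ D b c) Dab≡1 ⟩
    suc (D b c)   ∎
  potential-edge c {terminal a} {internal i j s _} (inj₁ (refl , refl)) =
    ⊓-glb
      (m≤n⇒m≤1+n (n≤1+n (D i c)))
      (begin
        D i c                 ≤⟨ triangle i c j ⟩
        D i j + D j c         ≤⟨ +-monoˡ-≤ (D j c) (m∸n≤1+m∸[1+n] (D i j) 0) ⟩
        suc (D i j ∸ 1) + D j c ∎)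
  potential-edge c {terminal a} {internal i j s _} (inj₂ (refl , e)) =
    ⊓-glb
      (begin
        D j c         ≤⟨ triangle j c i ⟩
        D j i + D i c ≡⟨ cong (_+ D i c) (trans (symm j i) (sym e)) ⟩
        suc (suc s) + D i c ∎)
      (m≤n⇒m≤1+n (m≤n+m (D j c) (D i j ∸ suc s)))
  potential-edge c {internal i j s _} {terminal a} (inj₁ (refl , refl)) =
    m⊓n≤m (suc (D i c)) (D i j ∸ 1 + D j c)
  potential-edge c {internal i j s _} {terminal a} (inj₂ (refl , e)) = begin
    (suc s + D i c) ⊓ (D i j ∸ suc s + D j c) ≤⟨ m⊓n≤n (suc s + D i c) _ ⟩
    D i j ∸ suc s + D j c                     ≡⟨ cong (λ d → d ∸ suc s + D j c) (sym e) ⟩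
    suc (suc s) ∸ suc s + D j c               ≡⟨ cong (_+ D j c) (m+n∸n≡m 1 s) ⟩
    suc (D j c)                               ∎
  potential-edge c {internal i j s _} {internal i j s′ _} (refl , refl , inj₁ refl) =
    ⊓-mono-≤
      (m≤n⇒m≤1+n (n≤1+n (suc s + D i c)))
      (+-monoˡ-≤ (D j c) (m∸n≤1+m∸[1+n] (D i j) (suc s)))
  potential-edge c {internal i j s _} {internal i j s′ _} (refl , refl , inj₂ refl) =
    ⊓-mono-≤ (≤-refl {suc (suc s′) + D i c})
      (m≤n⇒m≤1+n (+-monoˡ-≤ (D j c) (∸-monoʳ-≤ (D i j) (n≤1+n (suc s′)))))

  pairs : List (Fin n × Fin n)
  pairs = cartesianProduct (allFin n) (allFin n)

  pair∈pairs : ∀ i j → (i , j) ∈ pairs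
  pair∈pairs i j = ∈-cartesianProduct⁺ (∈-allFin i) (∈-allFin j)

  pathLength : Fin n × Fin n → ℕ
  pathLength = uncurry (pairTerm D q)

  extraVertices≡ : sum (map pathLength pairs) ≡ extraVertices D q
  extraVertices≡ = cong sum (map-uncurry-cartesianProduct (pairTerm D q) (allFin n) (allFin n))

  order : ℕ
  order = n + sum (map pathLength pairs)

  decode : Fin order → Vertex
  decode x = [ terminal , fromPathVertex ∘ fromFinSum pathLength pairs ]′ (splitAt n x)
    where
    fromPathVertex : Σ (Fin n × Fin n) (Fin ∘ pathLength) → Vertex
    fromPathVertex ((i , j) , t) = internal i j (toℕ t) (toℕ<n t)

  encode : Vertex → Fin order
  encode (terminal a)       = a ↑ˡ sum (map pathLength pairs)
  encode (internal i j s p) =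
    n ↑ʳ toFinSum pathLength (pair∈pairs i j) (fromℕ< p)

  internal-cong : ∀ {i j s s′} .{p p′} → s ≡ s′ → internal i j s p ≡ internal i j s′ p′
  internal-cong refl = refl

  decode-encode : ∀ v → decode (encode v) ≡ v
  decode-encode (terminal a) rewrite splitAt-↑ˡ n a (sum (map pathLength pairs)) = refl
  decode-encode (internal i j s p)
    rewrite splitAt-↑ʳ n (sum (map pathLength pairs))
                       (toFinSum pathLength (pair∈pairs i j) (fromℕ< p))
          | fromFinSum-toFinSum pathLength (pair∈pairs i j) (fromℕ< p)
    = internal-cong (toℕ-fromℕ< p)

  open RelationGraph edge? edge-sym edge-irrefl encode decode decode-encode
    renaming (related⇒adj to edge⇒adj)

  Φ : Fin n → Fin order
  Φ a = encode (terminal a)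

  Φ-injective : ∀ {a b} → Φ a ≡ Φ b → a ≡ b
  Φ-injective {a} {b} e with encode-injective {terminal a} {terminal b} e
  ... | refl = refl

  distance≤walk : ∀ {a b k} → Walk graph (Φ a) (Φ b) k → D a b ≤ k
  distance≤walk {a} {b} {k} w = begin
    D a b                            ≡⟨ cong (potential b) (decode-encode (terminal a)) ⟨
    potential b (decode (Φ a))       ≤⟨ Lipschitz⇒≤-walk (potential-edge b ∘ adj⇒related) w ⟩
    k + potential b (decode (Φ b))   ≡⟨ cong (λ v → k + potential b v) (decode-encode (terminal b)) ⟩
    k + D b b                        ≡⟨ cong (k +_) (diag b) ⟩
    k + 0                            ≡⟨ +-identityʳ k ⟩
    k                                ∎

  pairTerm-active : ∀ {i j} → toℕ i < toℕ j → 2 ≤ D i j → D i j ≤ q →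
                    pairTerm D q i j ≡ D i j ∸ 1
  pairTerm-active {i} {j} i<j 2≤D D≤q
    with (toℕ i <? toℕ j) ×-dec ((2 ≤? D i j) ×-dec (D i j ≤? q))
  ... | yes _     = refl
  ... | no ¬active = contradiction (i<j , 2≤D , D≤q) ¬active

  module Path {i j : Fin n} {d : ℕ} (i<j : toℕ i < toℕ j)
              (D≡ : D i j ≡ suc (suc d)) (2+d≤q : suc (suc d) ≤ q) where

    node : ∀ s → s < suc d → Vertex
    node s s<1+d = internal i j s (subst (s <_) (sym length≡) s<1+d)
      where
      length≡ : pairTerm D q i j ≡ suc d
      length≡ = begin-equality
        pairTerm D q i j ≡⟨ pairTerm-active i<j (subst (2 ≤_) (sym D≡) (s≤s (s≤s z≤n)))
                                                (subst (_≤ q) (sym D≡) 2+d≤q) ⟩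
        D i j ∸ 1        ≡⟨ cong (_∸ 1) D≡ ⟩
        suc d            ∎

    node→j : ∀ k s (s<1+d : s < suc d) → k + s ≡ d →
             Walk graph (encode (node s s<1+d)) (Φ j) (suc k)
    node→j zero    s s<1+d s≡d =
      step (edge⇒adj (node s s<1+d) (terminal j)
                     (inj₂ (refl , trans (cong (suc ∘ suc) s≡d) (sym D≡))))
           here
    node→j (suc k) s s<1+d k+s≡d =
      step (edge⇒adj (node s s<1+d) (node (suc s) 1+s<1+d) (refl , refl , inj₁ refl))
           (node→j k (suc s) 1+s<1+d (trans (+-suc k s) k+s≡d))
      where
      1+s<1+d : suc s < suc d
      1+s<1+d = s≤s (subst (suc s ≤_) k+s≡d (s≤s (m≤n+m s k)))

    i→j : Walk graph (Φ i) (Φ j) (suc (suc d))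
    i→j = step (edge⇒adj (terminal i) (node 0 z<s) (inj₁ (refl , refl)))
               (node→j d 0 z<s (+-identityʳ d))

  walk-skeleton-edge : ∀ {i j} → i ≢ j → D i j ≤ q → Walk graph (Φ i) (Φ j) (D i j)
  walk-skeleton-edge {i} {j} i≢j D≤q with D i j in D≡
  ... | zero        = contradiction (sym D≡) (<⇒≢ (offdiag i j i≢j))
  ... | suc zero    = step (edge⇒adj (terminal i) (terminal j) D≡) here
  ... | suc (suc d) with <-cmp (toℕ i) (toℕ j)
  ...   | tri< i<j _ _ = Path.i→j i<j D≡ D≤q
  ...   | tri≈ _ i≡j _ = contradiction (toℕ-injective i≡j) i≢j
  ...   | tri> _ _ j<i = walk-reverse (Path.i→j j<i (trans (symm j i) D≡) D≤q)

  skeletonWalk⇒walk : ∀ {i j L} → SkelWalk D q i j L → Walk graph (Φ i) (Φ j) L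
  skeletonWalk⇒walk here                = here
  skeletonWalk⇒walk (step i≢k D≤q rest) =
    walk-++ (walk-skeleton-edge i≢k D≤q) (skeletonWalk⇒walk rest)

  realisation : SkeletonExact D q → Realisation D order
  realisation exact = record
    { graph = graph
    ; Φ     = Φ
    ; Φ-inj = Φ-injective
    ; dist  = λ a b → skeletonWalk⇒walk (proj₁ (exact a b)) , λ _ → distance≤walk
    }

proposition3 : (n : ℕ) (D : Matrix n) → IsDistanceMatrix D →
    (q0 : ℕ) → IsLeastSkeletonIndex D q0 →
    Σ ℕ (λ m → Realisation D m × m ≤ n + extraVertices D q0)
-- Only D^(q0) = D is needed.
proposition3 n D D-dist q0 (exact , _) =
  order , realisation exact , ≤-reflexive (cong (n +_) extraVertices≡)
  where open SkeletonRealisation D-dist q0
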